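{- Let $d\ge 2$ and $1\le p < d$ be integers. Then $Q_d^{[\natural p]}$ is connected if and only if $p$ is odd.
   Context: The hypercube $Q_d$ has vertex set $\{0,1\}^d$, two vertices adjacent iff they differ in exactly one coordinate. For a graph $G$ and positive integer $p$, $G^{[\natural p]}$ is the graph on $V(G)$ in which two vertices are adjacent iff their distance in $G$ is exactly $p$ (for $Q_d$: iff they differ in exactly $p$ coordinates). -}

module Defs where

open import Data.Nat using (ℕ; zero; suc; _+_; _*_)
open import Data.Bool using (Bool; true; false; _≟_)
open import Data.Vec using (Vec; []; _∷_)
open import Data.Product using (Σ)
open import Relation.Nullary using (yes; no)
open import Relation.Binary.PropositionalEquality using (_≡_)
open import Relation.Binary.Construct.Closure.ReflexiveTransitive using (Star)

Cube : ℕ → Set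
Cube d = Vec Bool d

-- Hamming distance = graph distance in Q_d (number of differing coordinates).
hamming : ∀ {d} → Cube d → Cube d → ℕ
hamming [] [] = zero
hamming (x ∷ xs) (y ∷ ys) with x ≟ y
... | yes _ = hamming xs ys
... | no  _ = suc (hamming xs ys)

ExactDistAdj : (d p : ℕ) → Cube d → Cube d → Set
ExactDistAdj d p u v = hamming u v ≡ p

Connected : {V : Set} → (V → V → Set) → Set
Connected {V} E = (u v : V) → Star E u v

Odd : ℕ → Set
Odd p = Σ ℕ (λ k → p ≡ suc (2 * k))

-- Each edge of Q_d^[♮p] changes the parity of the Hamming distance to a fixed vertex by the
-- parity of p, so for even p no vertex at odd distance from 0 is reachable from 0. Conversely,
-- for 1 ≤ p < d, u and v are joined by a walk of length ≡ b (mod 2) whenever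
-- dist(u, v) ≡ b·p (mod 2); for odd p this holds with b = dist(u, v). In dimension d = p + 1 use the case (d - 1, p - 1), letting every step also
-- flip the first coordinate, after at most one step to the vertex with complemented tail. In
-- larger dimension use the case (d - 1, p) with the first coordinate fixed, after at most one
-- step that sets it right.
module Submission where

open import Defs
import Data.Nat as ℕ
open import Data.Nat using (ℕ; _≤_; _<_; zero; suc; z≤n; s≤s; parity)
open import Data.Nat.Properties using (m≤n⇒m<n∨m≡n; m+n≤o⇒n≤o; *-suc)
open import Function.Bundles using (_⇔_; mk⇔)
open import Data.Bool using (Bool; true; false; not; _≟_)
open import Data.Bool.Properties using (not-involutive; ¬-not)
open import Data.Parity.Base using (Parity; 0ℙ; 1ℙ; _⁻¹; _+_; _*_)
open import Data.Parity.Properties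
  using (+-homo-+; *-homo-*; +-cancelˡ-≡; +-identityʳ; p+p≡0ℙ; *-identityʳ; +-commutativeSemigroup)
open import Algebra.Properties.CommutativeSemigroup +-commutativeSemigroup using (interchange)
open import Data.Vec using ([]; _∷_; [_]; map; replicate)
open import Data.Product using (∃; _,_)
open import Data.Sum using (inj₁; inj₂)
open import Relation.Nullary using (¬_; yes; no; contradiction)
open import Relation.Binary.PropositionalEquality
  using (_≡_; refl; sym; trans; cong; cong₂; subst; module ≡-Reasoning)
open import Relation.Binary.Construct.Closure.ReflexiveTransitive using (Star; ε; _◅_)

open ≡-Reasoning

hamming-cons-same : ∀ {n} x {u v : Cube n} → hamming (x ∷ u) (x ∷ v) ≡ hamming u v
hamming-cons-same true  = refl
hamming-cons-same false = refl

hamming-cons-not : ∀ {n} x {u v : Cube n} → hamming (x ∷ u) (not x ∷ v) ≡ suc (hamming u v)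
hamming-cons-not true  = refl
hamming-cons-not false = refl

hamming-refl : ∀ {n} (u : Cube n) → hamming u u ≡ 0
hamming-refl []      = refl
hamming-refl (x ∷ u) = trans (hamming-cons-same x) (hamming-refl u)

hamming-map-not : ∀ {n} (u : Cube n) → hamming u (map not u) ≡ n
hamming-map-not []      = refl
hamming-map-not (x ∷ u) = trans (hamming-cons-not x) (cong suc (hamming-map-not u))

exists-at-distance : ∀ {k n} → k ≤ n → (u : Cube n) → ∃ λ v → hamming u v ≡ k
exists-at-distance z≤n u = u , hamming-refl u
exists-at-distance (s≤s k≤n) (x ∷ u) with exists-at-distance k≤n u
... | v , uv = not x ∷ v , trans (hamming-cons-not x) (cong suc uv)

parity-hamming-∷ : ∀ {n} x y (u v : Cube n) →
  parity (hamming (x ∷ u) (y ∷ v)) ≡ parity (hamming [ x ] [ y ]) + parity (hamming u v)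
parity-hamming-∷ true  true  u v = refl
parity-hamming-∷ false false u v = refl
parity-hamming-∷ true  false u v = +-homo-+ 1 (hamming u v)
parity-hamming-∷ false true  u v = +-homo-+ 1 (hamming u v)

parity-hamming-triangle : ∀ {n} (u v w : Cube n) →
  parity (hamming u w) ≡ parity (hamming u v) + parity (hamming v w)
parity-hamming-triangle []      []      []      = refl
parity-hamming-triangle (x ∷ u) (y ∷ v) (z ∷ w) = begin
  parity (hamming (x ∷ u) (z ∷ w))
    ≡⟨ parity-hamming-∷ x z u w ⟩
  parity (hamming [ x ] [ z ]) + parity (hamming u w)
    ≡⟨ cong₂ _+_ (bit-triangle x y z) (parity-hamming-triangle u v w) ⟩
  (parity (hamming [ x ] [ y ]) + parity (hamming [ y ] [ z ]))
    + (parity (hamming u v) + parity (hamming v w))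
    ≡⟨ interchange (parity (hamming [ x ] [ y ])) (parity (hamming [ y ] [ z ]))
                   (parity (hamming u v)) (parity (hamming v w)) ⟩
  (parity (hamming [ x ] [ y ]) + parity (hamming u v))
    + (parity (hamming [ y ] [ z ]) + parity (hamming v w))
    ≡⟨ sym (cong₂ _+_ (parity-hamming-∷ x y u v) (parity-hamming-∷ y z v w)) ⟩
  parity (hamming (x ∷ u) (y ∷ v)) + parity (hamming (y ∷ v) (z ∷ w)) ∎
  where
  bit-triangle : ∀ x y z →
    parity (hamming [ x ] [ z ]) ≡ parity (hamming [ x ] [ y ]) + parity (hamming [ y ] [ z ])
  bit-triangle true  true  z     = refl
  bit-triangle false false z     = refl
  bit-triangle true  false true  = refl
  bit-triangle true  false false = refl
  bit-triangle false true  true  = refl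
  bit-triangle false true  false = refl

flipBy : Parity → Bool → Bool
flipBy 0ℙ x = x
flipBy 1ℙ x = not x

flipBy-⁻¹ : ∀ b x → flipBy (b ⁻¹) x ≡ not (flipBy b x)
flipBy-⁻¹ 0ℙ x = refl
flipBy-⁻¹ 1ℙ x = sym (not-involutive x)

flipBy-⁻¹-not : ∀ b x → flipBy (b ⁻¹) (not x) ≡ flipBy b x
flipBy-⁻¹-not 0ℙ x = not-involutive x
flipBy-⁻¹-not 1ℙ x = refl

parity-hamming-flipBy : ∀ {n} b x (u v : Cube n) →
  parity (hamming (x ∷ u) (flipBy b x ∷ v)) ≡ b + parity (hamming u v)
parity-hamming-flipBy 0ℙ x u v = cong parity (hamming-cons-same x)
parity-hamming-flipBy 1ℙ x u v = trans (cong parity (hamming-cons-not x)) (+-homo-+ 1 (hamming u v))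

even-distance-invariant : ∀ {d p} → parity p ≡ 0ℙ → {u v : Cube d} →
  Star (ExactDistAdj d p) u v → parity (hamming u v) ≡ 0ℙ
even-distance-invariant even {u} ε = cong parity (hamming-refl u)
even-distance-invariant even {u} {v} (_◅_ {j = w} uw wv) =
  trans (parity-hamming-triangle u w v)
        (cong₂ _+_ (trans (cong parity uw) even) (even-distance-invariant even wv))

even-distance-disconnected : ∀ {d p} → 1 ≤ d → parity p ≡ 0ℙ → ¬ Connected (ExactDistAdj d p)
even-distance-disconnected {d} 1≤d even conn with exists-at-distance 1≤d (replicate d false)
... | v , uv = contradiction
  (trans (sym (cong parity uv)) (even-distance-invariant even (conn (replicate d false) v)))
  λ ()

data ParityWalk {V : Set} (E : V → V → Set) : Parity → V → V → Set where
  []  : ∀ {u} → ParityWalk E 0ℙ u u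
  _∷_ : ∀ {b u v w} → E u v → ParityWalk E (b ⁻¹) v w → ParityWalk E b u w

toStar : ∀ {V : Set} {E : V → V → Set} {b u v} → ParityWalk E b u v → Star E u v
toStar []      = ε
toStar (e ∷ w) = e ◅ toStar w

loopWalk : ∀ {V : Set} {E : V → V → Set} {u} → E u u → ∀ b → ParityWalk E b u u
loopWalk e 0ℙ = []
loopWalk e 1ℙ = e ∷ []

lift-fixed : ∀ {d p b x} {u v : Cube d} →
  ParityWalk (ExactDistAdj d p) b u v → ParityWalk (ExactDistAdj (suc d) p) b (x ∷ u) (x ∷ v)
lift-fixed []              = []
lift-fixed {x = x} (e ∷ w) = trans (hamming-cons-same x) e ∷ lift-fixed w

lift-flipping : ∀ {d p b x} {u v : Cube d} →
  ParityWalk (ExactDistAdj d p) b u v →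
  ParityWalk (ExactDistAdj (suc d) (suc p)) b (x ∷ u) (flipBy b x ∷ v)
lift-flipping []                          = []
lift-flipping {b = b} {x} {v = v} (e ∷ w) =
  trans (hamming-cons-not x) (cong suc e)
    ∷ subst (λ y → ParityWalk _ _ _ (y ∷ v)) (flipBy-⁻¹-not b x) (lift-flipping w)

-- The necessary condition for a walk of length parity b in Q_d^[♮p] to join u to v.
ParityConsistent : ∀ {d} → ℕ → Parity → Cube d → Cube d → Set
ParityConsistent p b u v = parity (hamming u v) ≡ b * parity p

consistent-step : ∀ {d p b} (u w v : Cube d) →
  hamming u w ≡ p → ParityConsistent p b u v → ParityConsistent p (b ⁻¹) w v
consistent-step {p = p} {b} u w v uw uv = +-cancelˡ-≡ (parity p) _ _ (begin
  parity p + parity (hamming w v)             ≡⟨ cong (λ r → parity r + parity (hamming w v)) (sym uw) ⟩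
  parity (hamming u w) + parity (hamming w v) ≡⟨ sym (parity-hamming-triangle u w v) ⟩
  parity (hamming u v)                        ≡⟨ uv ⟩
  b * parity p                                ≡⟨ split b (parity p) ⟩
  parity p + (b ⁻¹ * parity p)                ∎)
  where
  split : ∀ b r → b * r ≡ r + (b ⁻¹ * r)
  split 0ℙ r = sym (p+p≡0ℙ r)
  split 1ℙ r = sym (+-identityʳ r)

*-parity-suc : ∀ b m → b * parity (suc m) ≡ b + (b * parity m)
*-parity-suc 0ℙ m = refl
*-parity-suc 1ℙ m = +-homo-+ 1 m

walk-extend-flipping : ∀ {d q} →
  (∀ b (u v : Cube d) → ParityConsistent q b u v → ParityWalk (ExactDistAdj d q) b u v) →
  ∀ b x (u v : Cube d) → ParityConsistent (suc q) b (x ∷ u) (flipBy b x ∷ v) →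
  ParityWalk (ExactDistAdj (suc d) (suc q)) b (x ∷ u) (flipBy b x ∷ v)
walk-extend-flipping {q = q} walk b x u v uv = lift-flipping (walk b u v (+-cancelˡ-≡ b _ _ (begin
  b + parity (hamming u v)                   ≡⟨ sym (parity-hamming-flipBy b x u v) ⟩
  parity (hamming (x ∷ u) (flipBy b x ∷ v)) ≡⟨ uv ⟩
  b * parity (suc q)                         ≡⟨ *-parity-suc b q ⟩
  b + (b * parity q)                         ∎)))

walk-diagonal : ∀ n b (u v : Cube (suc n)) →
  ParityConsistent n b u v → ParityWalk (ExactDistAdj (suc n) n) b u v
walk-diagonal zero b  (true  ∷ []) (true  ∷ []) _  = loopWalk refl b
walk-diagonal zero b  (false ∷ []) (false ∷ []) _  = loopWalk refl b
walk-diagonal zero 0ℙ (true  ∷ []) (false ∷ []) ()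
walk-diagonal zero 1ℙ (true  ∷ []) (false ∷ []) ()
walk-diagonal zero 0ℙ (false ∷ []) (true  ∷ []) ()
walk-diagonal zero 1ℙ (false ∷ []) (true  ∷ []) ()
walk-diagonal (suc m) b (x ∷ u) (y ∷ v) uv with y ≟ flipBy b x
... | yes refl = walk-extend-flipping (walk-diagonal m) b x u v uv
... | no y≢ = to-complement ∷ subst (λ z → ParityWalk _ _ _ (z ∷ v)) (sym y≡) rest
  where
  y≡ : y ≡ flipBy (b ⁻¹) x
  y≡ = trans (¬-not y≢) (sym (flipBy-⁻¹ b x))

  to-complement : hamming (x ∷ u) (x ∷ map not u) ≡ suc m
  to-complement = trans (hamming-cons-same x) (hamming-map-not u)

  rest : ParityWalk (ExactDistAdj (suc (suc m)) (suc m)) (b ⁻¹)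
           (x ∷ map not u) (flipBy (b ⁻¹) x ∷ v)
  rest = walk-extend-flipping (walk-diagonal m) (b ⁻¹) x (map not u) v
           (subst (λ z → ParityConsistent (suc m) (b ⁻¹) (x ∷ map not u) (z ∷ v)) y≡
             (consistent-step (x ∷ u) (x ∷ map not u) (y ∷ v) to-complement uv))

walk-extend : ∀ {d q} → q ≤ d →
  (∀ b (u v : Cube d) → ParityConsistent (suc q) b u v → ParityWalk (ExactDistAdj d (suc q)) b u v) →
  ∀ b (u v : Cube (suc d)) → ParityConsistent (suc q) b u v →
  ParityWalk (ExactDistAdj (suc d) (suc q)) b u v
walk-extend {q = q} q≤d walk b (x ∷ u) (y ∷ v) uv with y ≟ x
... | yes refl = lift-fixed (walk b u v (trans (sym (cong parity (hamming-cons-same x))) uv))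
... | no y≢x with exists-at-distance q≤d u | ¬-not y≢x
...   | w , uw | refl = edge ∷ lift-fixed (walk (b ⁻¹) w v
                           (trans (sym (cong parity (hamming-cons-same (not x))))
                                  (consistent-step (x ∷ u) (not x ∷ w) (not x ∷ v) edge uv)))
  where
  edge : hamming (x ∷ u) (not x ∷ w) ≡ suc q
  edge = trans (hamming-cons-not x) (cong suc uw)

walk-exists : ∀ {d q} → suc q < d → ∀ b (u v : Cube d) →
  ParityConsistent (suc q) b u v → ParityWalk (ExactDistAdj d (suc q)) b u v
walk-exists {suc d} (s≤s q<d) with m≤n⇒m<n∨m≡n q<d
... | inj₁ q+1<d = walk-extend (m+n≤o⇒n≤o 2 q+1<d) (walk-exists q+1<d)
... | inj₂ refl  = walk-diagonal _

odd-distance-connected : ∀ {d q} → suc q < d → parity (suc q) ≡ 1ℙ →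
  Connected (ExactDistAdj d (suc q))
odd-distance-connected q<d odd u v =
  toStar (walk-exists q<d b u v (trans (sym (*-identityʳ b)) (cong (b *_) (sym odd))))
  where
  b = parity (hamming u v)

Odd⇒parity≡1ℙ : ∀ {n} → Odd n → parity n ≡ 1ℙ
Odd⇒parity≡1ℙ (k , refl) = trans (+-homo-+ 1 (2 ℕ.* k)) (cong _⁻¹ (*-homo-* 2 k))

parity≡1ℙ⇒Odd : ∀ n → parity n ≡ 1ℙ → Odd n
parity≡1ℙ⇒Odd zero          ()
parity≡1ℙ⇒Odd (suc zero)    _ = 0 , refl
parity≡1ℙ⇒Odd (suc (suc n)) e with parity≡1ℙ⇒Odd n e
... | k , refl = suc k , cong suc (sym (*-suc 2 k))

theorem3p5 : (d p : ℕ) → 2 ≤ d → 1 ≤ p → p < d →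
    (Connected (ExactDistAdj d p) ⇔ Odd p)
theorem3p5 d zero    _   ()  _
theorem3p5 d (suc q) 2≤d _   q<d = mk⇔ connected⇒odd odd⇒connected
  where
  connected⇒odd : Connected (ExactDistAdj d (suc q)) → Odd (suc q)
  connected⇒odd conn with parity (suc q) in eq
  ... | 0ℙ = contradiction conn (even-distance-disconnected (m+n≤o⇒n≤o 1 2≤d) eq)
  ... | 1ℙ = parity≡1ℙ⇒Odd (suc q) eq

  odd⇒connected : Odd (suc q) → Connected (ExactDistAdj d (suc q))
  odd⇒connected o = odd-distance-connected q<d (Odd⇒parity≡1ℙ o)
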